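{- Let $G=(V,E)$ be a graph and $a,b\in V$ with $ab\in E$, $C_G(b)<C_G(a)$ and $R_G(a,b)<\frac23$, and let $u\in N_G(b)$. If $C_{G+au}(a)\le C_{G+au}(b)$, then $R_{G+au}(a,b)\ge\frac23$.
   Context: All graphs are finite, simple, undirected, unweighted and connected. $d_G(u,v)$ is the shortest-path distance, $C_G(v)=\sum_{u\in V}d_G(u,v)$ is the closeness centrality of $v$, and $R_G(a,b)=\frac{\min(C_G(a),C_G(b))}{\max(C_G(a),C_G(b))}$ is the closeness ratio. $N_G(b)$ is the open neighborhood of $b$ in $G$. $G+au$ denotes the graph obtained from $G$ by adding the edge $au$. -}

module Defs where

open import Data.Bool using (Bool; true; false; _∧_; _∨_; not; if_then_else_)
open import Data.Nat using (ℕ; zero; suc; _⊓_; _⊔_)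
open import Data.Fin using (Fin; _≟_)
open import Data.List using (map; allFin)
open import Data.Bool.ListAction using (any)
open import Data.Nat.ListAction using (sum)
open import Data.Integer using (+_)
open import Data.Rational using (ℚ; _/_; 0ℚ)
open import Relation.Nullary.Decidable using (⌊_⌋)
open import Relation.Binary.PropositionalEquality using (_≡_)
open import Data.Product using (∃; _×_)

Graph : ℕ → Set
Graph n = Fin n → Fin n → Bool

IsSimple : ∀ {n} → Graph n → Set
IsSimple {n} G = (∀ (x y : Fin n) → G x y ≡ G y x) × (∀ (x : Fin n) → G x x ≡ false)

reach : ∀ {n} → Graph n → ℕ → Fin n → Fin n → Bool
reach {n} G zero    u v = ⌊ u ≟ v ⌋
reach {n} G (suc k) u v = reach G k u v ∨ any (λ w → G u w ∧ reach G k w v) (allFin n)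

Connected : ∀ {n} → Graph n → Set
Connected {n} G = ∀ (u v : Fin n) → ∃ λ k → reach G k u v ≡ true

-- least k in [start, start+fuel) with p k = true, else start+fuel
firstFrom : (ℕ → Bool) → ℕ → ℕ → ℕ
firstFrom p k zero       = k
firstFrom p k (suc fuel) = if p k then k else firstFrom p (suc k) fuel

-- shortest-path distance d_G(u,v): least k such that a walk of length ≤ k exists
-- (in a connected graph on n vertices this is < n, so searching k < n suffices)
dist : ∀ {n} → Graph n → Fin n → Fin n → ℕ
dist {n} G u v = firstFrom (λ k → reach G k u v) 0 n

closeness : ∀ {n} → Graph n → Fin n → ℕ
closeness {n} G v = sum (map (λ u → dist G u v) (allFin n))

-- min(x,y)/max(x,y) as a rational (value 0 in the degenerate case max = 0)
ratioℕ : ℕ → ℕ → ℚ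
ratioℕ x y with x ⊔ y
... | zero  = 0ℚ
... | suc m = (+ (x ⊓ y)) / suc m

closenessRatio : ∀ {n} → Graph n → Fin n → Fin n → ℚ
closenessRatio G a b = ratioℕ (closeness G a) (closeness G b)

-- G + au : add the (undirected) edge au (no loop is created if a = u)
addEdge : ∀ {n} → Graph n → Fin n → Fin n → Graph n
addEdge G a u x y =
  G x y ∨ (((⌊ x ≟ a ⌋ ∧ ⌊ y ≟ u ⌋) ∨ (⌊ x ≟ u ⌋ ∧ ⌊ y ≟ a ⌋)) ∧ not ⌊ x ≟ y ⌋)

{-# OPTIONS --safe #-}
module Submission where

-- Adding the edge au only shortens distances, so C_{G+au}(b) ≤ C_G(b).  Distances to a
-- cannot shrink much: cutting a walk to a in G + au at its first use of the new edge shows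
-- d_{G+au}(x,a) ≥ min(d_G(x,a), d_G(x,b)), since from u the edge ub reaches b at once.
-- Together with d_G(x,a) ≤ d_G(x,b) + 1 this gives 2 d_G(x,a) ≤ 3 d_{G+au}(x,a) + d_G(x,b)
-- for every vertex x; summing, 2 C_G(a) ≤ 3 C_{G+au}(a) + C_G(b).  As R_G(a,b) < 2/3 means
-- 3 C_G(b) < 2 C_G(a), we get 2 C_{G+au}(b) ≤ 2 C_G(b) < 3 C_{G+au}(a), which is the claim
-- once C_{G+au}(a) ≤ C_{G+au}(b).

open import Defs
open import Data.Nat using (ℕ; _<_; _≤_)
open import Data.Fin using (Fin)
open import Data.Bool using (true)
open import Data.Integer using (+_)
open import Data.Rational using (_/_)
open import Relation.Binary.PropositionalEquality using (_≡_)
import Data.Rational as ℚ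

open import Data.Nat using (zero; suc; _+_; _*_; _⊓_; z≤n; s≤s)
open import Data.Nat.Properties hiding (_≟_)
open import Data.Nat.Tactic.RingSolver using (solve-∀)
open import Algebra.Properties.CommutativeSemigroup +-commutativeSemigroup
  using () renaming (interchange to +-interchange)
open import Data.Nat.ListAction using (sum)
open import Data.Bool using (Bool; T; false)
open import Data.Bool.Properties using (T-≡; T-∨; T-∧; ∨-identityʳ)
open import Data.Fin using (_≟_)
open import Data.Fin.Properties using (toℕ<n)
open import Data.List using ([]; _∷_; map; allFin)
open import Data.List.Membership.Propositional using (lose)
open import Data.List.Membership.Propositional.Properties using (∈-allFin)
open import Data.List.Relation.Unary.Any using (satisfied)
open import Data.List.Relation.Unary.Any.Properties using (any⁺; any⁻)
open import Data.Product using (_,_)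
open import Data.Sum using (_⊎_; inj₁; inj₂; [_,_]′)
import Data.Sum as Sum
open import Data.Empty using (⊥-elim)
open import Function.Base using (_∘_)
open import Function.Bundles using (Equivalence)
open import Relation.Nullary using (yes; no)
open import Relation.Nullary.Decidable using (toWitness; fromWitness)
open import Relation.Binary.PropositionalEquality using (refl; sym; trans; cong; subst; subst₂; _≢_)
import Data.Integer as ℤ
import Data.Integer.Properties as ℤP
import Data.Rational.Properties as ℚP
import Data.Rational.Unnormalised as ℚᵘ
import Data.Rational.Unnormalised.Properties as ℚᵘP

open Equivalence using (to; from)

-- As in reach, the index k bounds the length of the walk from above.
data Walk {n : ℕ} (G : Graph n) : ℕ → Fin n → Fin n → Set where
  stay : ∀ {k x} → Walk G k x x
  step : ∀ {k x w v} → T (G x w) → Walk G k w v → Walk G (suc k) x v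

module _ {n : ℕ} {G : Graph n} where

  walk-suc : ∀ {k x v} → Walk G k x v → Walk G (suc k) x v
  walk-suc stay       = stay
  walk-suc (step e p) = step e (walk-suc p)

  walk-snoc : ∀ {k x w v} → Walk G k x w → T (G w v) → Walk G (suc k) x v
  walk-snoc stay        e = step e stay
  walk-snoc (step e′ p) e = step e′ (walk-snoc p e)

  walk-zero : ∀ {x v} → Walk G 0 x v → x ≡ v
  walk-zero stay = refl

  reach-refl : ∀ k v → T (reach G k v v)
  reach-refl zero    v = fromWitness refl
  reach-refl (suc k) v = from T-∨ (inj₁ (reach-refl k v))

  walk⇒reach : ∀ {k x v} → Walk G k x v → T (reach G k x v)
  walk⇒reach {k} {x} stay = reach-refl k x
  walk⇒reach (step {k} {x} {w} {v} e p) =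
    from (T-∨ {reach G k x v}) (inj₂ (any⁺ _ (lose (∈-allFin w) (from T-∧ (e , walk⇒reach p)))))

  reach⇒walk : ∀ k {x v} → T (reach G k x v) → Walk G k x v
  reach⇒walk zero r with toWitness r
  ... | refl = stay
  reach⇒walk (suc k) {x} {v} r with to (T-∨ {reach G k x v}) r
  ... | inj₁ r′ = walk-suc (reach⇒walk k r′)
  ... | inj₂ r′ with satisfied (any⁻ _ (allFin n) r′)
  ...   | w , e with to T-∧ e
  ...     | e′ , r″ = step e′ (reach⇒walk k r″)

_⊆_ : ∀ {n} → Graph n → Graph n → Set
_⊆_ {n} G H = ∀ {x y : Fin n} → T (G x y) → T (H x y)

walk-⊆ : ∀ {n} {G H : Graph n} → G ⊆ H → ∀ {k x v} → Walk G k x v → Walk H k x v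
walk-⊆ G⊆H stay       = stay
walk-⊆ G⊆H (step e p) = step (G⊆H e) (walk-⊆ G⊆H p)

module _ {n : ℕ} {G : Graph n} {a u : Fin n} where

  ⊆-addEdge : G ⊆ addEdge G a u
  ⊆-addEdge e = from T-∨ (inj₁ e)

  addEdge-edge : ∀ {x y} → T (addEdge G a u x y) → T (G x y) ⊎ x ≡ a ⊎ x ≡ u
  addEdge-edge {x} {y} e with x ≟ a | x ≟ u
  ... | yes x≡a | _       = inj₂ (inj₁ x≡a)
  ... | no _    | yes x≡u = inj₂ (inj₂ x≡u)
  ... | no _    | no _    = inj₁ (subst T (∨-identityʳ (G x y)) e)

  walk-addEdge : ∀ {b} → T (G u b) → ∀ {k x} → Walk (addEdge G a u) k x a →
                 Walk G k x a ⊎ Walk G k x b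
  walk-addEdge ub stay = inj₁ stay
  walk-addEdge ub (step e p) with addEdge-edge e
  ... | inj₁ e′         = Sum.map (step e′) (step e′) (walk-addEdge ub p)
  ... | inj₂ (inj₁ refl) = inj₁ stay
  ... | inj₂ (inj₂ refl) = inj₂ (step ub stay)

firstFrom-≤ : ∀ (p : ℕ → Bool) {s k} f → T (p k) → s ≤ k → firstFrom p s f ≤ k
firstFrom-≤ p zero       pk s≤k = s≤k
firstFrom-≤ p {s} (suc f) pk s≤k with p s in ps
... | true  = s≤k
... | false = firstFrom-≤ p f pk (≤∧≢⇒< s≤k λ { refl → subst T ps pk })

firstFrom-≤-+ : ∀ (p : ℕ → Bool) s f → firstFrom p s f ≤ s + f
firstFrom-≤-+ p s zero    = ≤-reflexive (sym (+-identityʳ s))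
firstFrom-≤-+ p s (suc f) with p s
... | true  = m≤m+n s (suc f)
... | false = ≤-trans (firstFrom-≤-+ p (suc s) f) (≤-reflexive (sym (+-suc s f)))

firstFrom-found : ∀ (p : ℕ → Bool) s f → T (p (firstFrom p s f)) ⊎ firstFrom p s f ≡ s + f
firstFrom-found p s zero    = inj₂ (sym (+-identityʳ s))
firstFrom-found p s (suc f) with p s in ps
... | true  = inj₁ (subst T (sym ps) _)
... | false = Sum.map₂ (λ end → trans end (sym (+-suc s f))) (firstFrom-found p (suc s) f)

module _ {n : ℕ} (G : Graph n) where

  dist-≤ : ∀ {k x v} → Walk G k x v → dist G x v ≤ k
  dist-≤ p = firstFrom-≤ _ n (walk⇒reach p) z≤n

  dist-≤-n : ∀ x v → dist G x v ≤ n
  dist-≤-n x v = firstFrom-≤-+ _ 0 n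

  dist-walk : ∀ x v → Walk G (dist G x v) x v ⊎ dist G x v ≡ n
  dist-walk x v = Sum.map₁ (reach⇒walk (dist G x v)) (firstFrom-found _ 0 n)

  ≤-dist : ∀ {j} x v → j ≤ n → (∀ {k} → Walk G k x v → j ≤ k) → j ≤ dist G x v
  ≤-dist x v j≤n below-walks with dist-walk x v
  ... | inj₁ p   = below-walks p
  ... | inj₂ d≡n = subst (_ ≤_) (sym d≡n) j≤n

  dist-pos : ∀ {x v} → x ≢ v → 0 < dist G x v
  dist-pos {x} {v} x≢v = ≤-dist x v (≤-trans (s≤s z≤n) (toℕ<n x)) walk-pos
    where
    walk-pos : ∀ {k} → Walk G k x v → 0 < k
    walk-pos {zero}  p = ⊥-elim (x≢v (walk-zero p))
    walk-pos {suc k} p = s≤s z≤n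

  dist-edge : ∀ {c e} → T (G c e) → ∀ x → dist G x e ≤ suc (dist G x c)
  dist-edge {c} {e} ce x with dist-walk x c
  ... | inj₁ p   = dist-≤ (walk-snoc p ce)
  ... | inj₂ d≡n = ≤-trans (dist-≤-n x e) (≤-trans (n≤1+n n) (s≤s (≤-reflexive (sym d≡n))))

dist-⊆ : ∀ {n} {G H : Graph n} → G ⊆ H → ∀ x v → dist H x v ≤ dist G x v
dist-⊆ {G = G} {H} G⊆H x v = ≤-dist G x v (dist-≤-n H x v) (λ p → dist-≤ H (walk-⊆ G⊆H p))

dist-addEdge-⊓ : ∀ {n} {G : Graph n} {a b u} → T (G u b) → ∀ x →
                 dist G x a ⊓ dist G x b ≤ dist (addEdge G a u) x a
dist-addEdge-⊓ {G = G} {a} {b} {u} ub x =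
  ≤-dist (addEdge G a u) x a (≤-trans (m⊓n≤m _ _) (dist-≤-n G x a))
    (λ p → [ (λ pa → ≤-trans (m⊓n≤m _ _) (dist-≤ G pa))
           , (λ pb → ≤-trans (m⊓n≤n _ _) (dist-≤ G pb)) ]′ (walk-addEdge ub p))

0<n⇒m≤1+n⇒m⊓n≤o⇒2m≤3o+n : ∀ {m n o} → 0 < n → m ≤ suc n → m ⊓ n ≤ o → 2 * m ≤ 3 * o + n
0<n⇒m≤1+n⇒m⊓n≤o⇒2m≤3o+n {m} {n} {o} 0<n m≤1+n m⊓n≤o with ≤-total m n
... | inj₁ m≤n = begin
  2 * m        ≤⟨ *-monoˡ-≤ m (n≤1+n 2) ⟩
  3 * m        ≡⟨ cong (3 *_) (m≤n⇒m⊓n≡m m≤n) ⟨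
  3 * (m ⊓ n)  ≤⟨ *-monoʳ-≤ 3 m⊓n≤o ⟩
  3 * o        ≤⟨ m≤m+n (3 * o) n ⟩
  3 * o + n    ∎
  where open ≤-Reasoning
... | inj₂ n≤m = begin
  2 * m          ≤⟨ *-monoʳ-≤ 2 m≤1+n ⟩
  2 * suc n      ≡⟨ *-suc 2 n ⟩
  2 + 2 * n      ≤⟨ +-monoˡ-≤ (2 * n) (*-monoʳ-≤ 2 0<n) ⟩
  2 * n + 2 * n  ≡⟨ twice-double n ⟩
  3 * n + n      ≤⟨ +-monoˡ-≤ n (*-monoʳ-≤ 3 (subst (_≤ o) (m≥n⇒m⊓n≡n n≤m) m⊓n≤o)) ⟩
  3 * o + n      ∎
  where
  open ≤-Reasoning
  twice-double : ∀ n → 2 * n + 2 * n ≡ 3 * n + n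
  twice-double = solve-∀

dist-addEdge-bound : ∀ {n} {G : Graph n} {a b u} → a ≢ b → T (G b a) → T (G u b) →
                     ∀ x → 2 * dist G x a ≤ 3 * dist (addEdge G a u) x a + dist G x b
dist-addEdge-bound {G = G} {a} {b} {u} a≢b ba ub x with x ≟ b
... | no x≢b = 0<n⇒m≤1+n⇒m⊓n≤o⇒2m≤3o+n (dist-pos G x≢b) (dist-edge G ba x) (dist-addEdge-⊓ ub x)
... | yes refl = begin
  2 * dist G b a                               ≤⟨ *-monoʳ-≤ 2 (dist-≤ G (step ba (stay {k = 0}))) ⟩
  2                                            ≤⟨ n≤1+n 2 ⟩
  3 * 1                                        ≤⟨ *-monoʳ-≤ 3 (dist-pos (addEdge G a u) (a≢b ∘ sym)) ⟩
  3 * dist (addEdge G a u) b a                 ≤⟨ m≤m+n _ _ ⟩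
  3 * dist (addEdge G a u) b a + dist G b b    ∎
  where open ≤-Reasoning

module _ {A : Set} where

  sum-map-mono-≤ : ∀ {f g : A → ℕ} → (∀ x → f x ≤ g x) → ∀ xs → sum (map f xs) ≤ sum (map g xs)
  sum-map-mono-≤ f≤g []       = z≤n
  sum-map-mono-≤ f≤g (x ∷ xs) = +-mono-≤ (f≤g x) (sum-map-mono-≤ f≤g xs)

  sum-map-+ : ∀ (f g : A → ℕ) xs →
              sum (map (λ x → f x + g x) xs) ≡ sum (map f xs) + sum (map g xs)
  sum-map-+ f g []       = refl
  sum-map-+ f g (x ∷ xs) =
    trans (cong (_+_ (f x + g x)) (sum-map-+ f g xs)) (+-interchange (f x) (g x) _ _)

  sum-map-*ˡ : ∀ c (f : A → ℕ) xs → sum (map (λ x → c * f x) xs) ≡ c * sum (map f xs)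
  sum-map-*ˡ c f []       = sym (*-zeroʳ c)
  sum-map-*ˡ c f (x ∷ xs) =
    trans (cong (_+_ (c * f x)) (sum-map-*ˡ c f xs)) (sym (*-distribˡ-+ c (f x) _))

closeness-⊆ : ∀ {n} {G H : Graph n} → G ⊆ H → ∀ v → closeness H v ≤ closeness G v
closeness-⊆ {n} G⊆H v = sum-map-mono-≤ (λ x → dist-⊆ G⊆H x v) (allFin n)

closeness-addEdge-bound : ∀ {n} {G : Graph n} {a b u} → a ≢ b → T (G b a) → T (G u b) →
                          2 * closeness G a ≤ 3 * closeness (addEdge G a u) a + closeness G b
closeness-addEdge-bound {n} {G} {a} {b} {u} a≢b ba ub = begin
  2 * closeness G a                                  ≡⟨ sum-map-*ˡ 2 α xs ⟨
  sum (map (λ x → 2 * α x) xs)                       ≤⟨ sum-map-mono-≤ (dist-addEdge-bound a≢b ba ub) xs ⟩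
  sum (map (λ x → 3 * α′ x + β x) xs)                ≡⟨ sum-map-+ (λ x → 3 * α′ x) β xs ⟩
  sum (map (λ x → 3 * α′ x) xs) + closeness G b      ≡⟨ cong (_+ closeness G b) (sum-map-*ˡ 3 α′ xs) ⟩
  3 * closeness (addEdge G a u) a + closeness G b    ∎
  where
  open ≤-Reasoning
  xs = allFin n
  α α′ β : Fin n → ℕ
  α  x = dist G x a
  α′ x = dist (addEdge G a u) x a
  β  x = dist G x b

module _ {a b c d : ℕ} where

  *<*⇒/</ : a * suc d < c * suc b → (+ a) / suc b ℚ.< (+ c) / suc d
  *<*⇒/</ ad<cb = ℚP.toℚᵘ-cancel-<
    (ℚᵘP.<-respˡ-≃ (ℚᵘP.≃-sym (ℚP.toℚᵘ-fromℚᵘ (ℚᵘ.mkℚᵘ (+ a) b)))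
      (ℚᵘP.<-respʳ-≃ (ℚᵘP.≃-sym (ℚP.toℚᵘ-fromℚᵘ (ℚᵘ.mkℚᵘ (+ c) d)))
        (ℚᵘ.*<* (subst₂ ℤ._<_ (ℤP.pos-* a (suc d)) (ℤP.pos-* c (suc b)) (ℤ.+<+ ad<cb)))))

  /</⇒*<* : (+ a) / suc b ℚ.< (+ c) / suc d → a * suc d < c * suc b
  /</⇒*<* a/b<c/d = ℤP.drop‿+<+
    (subst₂ ℤ._<_ (sym (ℤP.pos-* a (suc d))) (sym (ℤP.pos-* c (suc b)))
      (ℚᵘP.drop-*<* (ℚᵘP.<-respˡ-≃ (ℚP.toℚᵘ-fromℚᵘ (ℚᵘ.mkℚᵘ (+ a) b))
        (ℚᵘP.<-respʳ-≃ (ℚP.toℚᵘ-fromℚᵘ (ℚᵘ.mkℚᵘ (+ c) d)) (ℚP.toℚᵘ-mono-< a/b<c/d)))))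

ratioℕ-≥ : ∀ {m y} → y ≤ suc m → ratioℕ (suc m) y ≡ (+ y) / suc m
ratioℕ-≥ y≤x rewrite m≥n⇒m⊔n≡m y≤x | m≥n⇒m⊓n≡n y≤x = refl

ratioℕ-≤ : ∀ {x m} → x ≤ suc m → ratioℕ x (suc m) ≡ (+ x) / suc m
ratioℕ-≤ x≤y rewrite m≤n⇒m⊔n≡n x≤y | m≤n⇒m⊓n≡m x≤y = refl

ratioℕ<⇒ : ∀ {x y p q} → y < x → ratioℕ x y ℚ.< (+ p) / suc q → y * suc q < p * x
ratioℕ<⇒ {suc m} {y} {p} {q} y<x r = /</⇒*<* {y} {m} {p} {q} (subst (ℚ._< _) (ratioℕ-≥ (<⇒≤ y<x)) r)

<ratioℕ : ∀ {x y p q} → x ≤ y → p * y < x * suc q → (+ p) / suc q ℚ.< ratioℕ x y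
<ratioℕ {y = zero}  z≤n ()
<ratioℕ {x} {suc m} {p} {q} x≤y py<xq =
  subst (_ ℚ.<_) (sym (ratioℕ-≤ x≤y)) (*<*⇒/</ {p} {q} {x} {m} py<xq)

-- Connectedness is not needed: every lemma above also holds with the junk distance n
-- between unreachable vertices.
lemma2 : ∀ (n : ℕ) (G : Graph n) → IsSimple G → Connected G →
    ∀ (a b u : Fin n) →
    G a b ≡ true →
    closeness G b < closeness G a →
    closenessRatio G a b ℚ.< (+ 2) / 3 →
    G b u ≡ true →
    closeness (addEdge G a u) a ≤ closeness (addEdge G a u) b →
    (+ 2) / 3 ℚ.≤ closenessRatio (addEdge G a u) a b
lemma2 n G (symmetric , loopless) _ a b u ab Cb<Ca R<⅔ bu C′a≤C′b =
  ℚP.<⇒≤ (<ratioℕ {p = 2} {q = 2} C′a≤C′b 2C′b<3C′a)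
  where
  open ≤-Reasoning
  H = addEdge G a u
  edge : ∀ {x y} → G x y ≡ true → T (G x y)
  edge = from T-≡
  a≢b : a ≢ b
  a≢b refl = subst T (loopless a) (edge ab)
  Cb C′a : ℕ
  Cb  = closeness G b
  C′a = closeness H a
  2Cb<3C′a : 2 * Cb < 3 * C′a
  2Cb<3C′a = +-cancelʳ-< Cb _ _ (begin-strict
    2 * Cb + Cb         ≡⟨ +-comm (2 * Cb) Cb ⟩
    3 * Cb              ≡⟨ *-comm 3 Cb ⟩
    Cb * 3              <⟨ ratioℕ<⇒ {p = 2} {q = 2} Cb<Ca R<⅔ ⟩
    2 * closeness G a   ≤⟨ closeness-addEdge-bound a≢b (edge (trans (symmetric b a) ab))
                                                       (edge (trans (symmetric u b) bu)) ⟩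
    3 * C′a + Cb        ∎)
  2C′b<3C′a : 2 * closeness H b < C′a * 3
  2C′b<3C′a = begin-strict
    2 * closeness H b   ≤⟨ *-monoʳ-≤ 2 (closeness-⊆ (⊆-addEdge {G = G} {a} {u}) b) ⟩
    2 * Cb              <⟨ 2Cb<3C′a ⟩
    3 * C′a             ≡⟨ *-comm 3 C′a ⟩
    C′a * 3             ∎
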